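{- Let $p$ be a prime with $p\equiv 1\pmod 4$, let $\omega(p)$ be the unique integer with $0<\omega(p)<p/2$ and $\omega(p)^2\equiv -1\pmod p$, and let $\square_p=\{i^2\mid i\in\mathbb{Z}_p\}$. Then the set $$\mathcal{P}=\{(q,\omega(p)q)\mid q\in\square_p\}\cup\{(q,-\omega(p)q)\mid q\in\square_p\}\subseteq\mathbb{Z}_p^2$$ has exactly $p$ elements, any two of its points are at integral distance, and $\mathcal{P}$ is not collinear.
   Context: $\mathbb{Z}_p=\mathbb{Z}/p\mathbb{Z}$. Two points $(u_1,u_2),(v_1,v_2)\in\mathbb{Z}_p^2$ are at integral distance if there exists $d\in\mathbb{Z}_p$ with $(u_1-v_1)^2+(u_2-v_2)^2=d^2$. A set of $r$ points $(u_i,v_i)\in\mathbb{Z}_p^2$ ($1\le i\le r$) is collinear if there exist $a,b,t_1,t_2\in\mathbb{Z}_p$ and $w_1,\dots,w_r\in\mathbb{Z}_p$ with $a+w_it_1=u_i$ and $b+w_it_2=v_i$ for all $i$. -}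

module Defs where

open import Data.Nat using (ℕ; _∸_; NonZero) renaming (_+_ to _+ℕ_; _*_ to _*ℕ_)
open import Data.Nat.DivMod using (_mod_)
open import Data.Fin using (Fin; toℕ)
open import Data.Product using (_×_; _,_; ∃; ∃-syntax)
open import Data.Sum using (_⊎_)
open import Data.List using (List)
open import Data.List.Membership.Propositional using (_∈_)
open import Relation.Binary.PropositionalEquality using (_≡_)

ℤ_ : (p : ℕ) → Set
ℤ p = Fin p

module _ {p : ℕ} .{{_ : NonZero p}} where

  infixl 6 _+ₚ_ _-ₚ_
  infixl 7 _*ₚ_

  _+ₚ_ : ℤ p → ℤ p → ℤ p
  x +ₚ y = (toℕ x +ℕ toℕ y) mod p

  _*ₚ_ : ℤ p → ℤ p → ℤ p
  x *ₚ y = (toℕ x *ℕ toℕ y) mod p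

  -ₚ_ : ℤ p → ℤ p
  -ₚ x = (p ∸ toℕ x) mod p

  _-ₚ_ : ℤ p → ℤ p → ℤ p
  x -ₚ y = x +ₚ (-ₚ y)

  [_]ₚ : ℕ → ℤ p
  [ n ]ₚ = n mod p

  Point : Set
  Point = ℤ p × ℤ p

  IsSquare : ℤ p → Set
  IsSquare q = ∃[ i ] q ≡ i *ₚ i

  IntegralDistance : Point → Point → Set
  IntegralDistance (u₁ , u₂) (v₁ , v₂) =
    ∃[ d ] ((u₁ -ₚ v₁) *ₚ (u₁ -ₚ v₁)) +ₚ ((u₂ -ₚ v₂) *ₚ (u₂ -ₚ v₂)) ≡ d *ₚ d

  Collinear : (Point → Set) → Set
  Collinear S = ∃[ a ] ∃[ b ] ∃[ t₁ ] ∃[ t₂ ]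
    (∀ {u v} → S (u , v) → ∃[ w ] ((a +ₚ w *ₚ t₁ ≡ u) × (b +ₚ w *ₚ t₂ ≡ v)))

  InP : ℕ → Point → Set
  InP ω (x , y) =
    (IsSquare x × y ≡ [ ω ]ₚ *ₚ x) ⊎ (IsSquare x × y ≡ -ₚ ([ ω ]ₚ *ₚ x))

module Submission where

-- Let p = 2h + 1 be a prime and ω̂ = [ω] a square root of -1 in ℤ_p (p ∣ ω² + 1, 0 < 2ω < p).
-- The set 𝒫 lies on the two lines y = ω̂x and y = -ω̂x, which are isotropic: along them
-- (Δx)² + (Δy)² = (Δx)²(1 + ω̂²) = 0.  Between the lines, (i² - j²)² + ω̂²(i² + j²)²
-- equals (2ω̂ij)² modulo 1 + ω̂².  The triangle (1, ω̂), (0, 0), (1, -ω̂) has area 2ω̂ ≠ 0,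
-- so 𝒫 is not collinear.  Finally the squares 0², 1², …, h² are distinct and exhaust □_p,
-- and ω̂n² ≠ -ω̂n² for 0 < n ≤ h, so 𝒫 has exactly (h + 1) + h = p points.

open import Defs
open import Data.Nat as ℕ using (ℕ; NonZero; zero; suc; _∸_; _%_)
import Data.Nat.Properties as ℕₚ
open import Data.Nat.DivMod using (m≡m%n+[m/n]*n)
import Data.Nat.Divisibility as ℕ∣
open import Data.Nat.Primality using (Prime; euclidsLemma)
import Data.Integer as Int
open Int using (ℤ; +_; -[1+_]; ∣_∣)
import Data.Integer.Properties as ℤₚ
import Data.Integer.Tactic.RingSolver as ℤ-Solver
import Tactic.RingSolver.NonReflective ℤ-Solver.ring as ℤ-Reflection
import Tactic.RingSolver.Core.AlmostCommutativeRing as ACR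
open import Tactic.RingSolver.Core.Expression using (Expr; Κ; Ι; _⊕_; _⊗_; _⊛_; ⊝_; module Eval)
open import Algebra.Bundles.Raw using (RawRing)
import Algebra.Definitions.RawSemiring as Power
open import Data.Fin using (Fin; toℕ; fromℕ<)
open import Data.Fin.Properties using (toℕ-injective; toℕ<n; toℕ-fromℕ<)
open import Data.Vec using (Vec)
import Data.Vec as Vec
open import Data.Vec.Properties using (lookup-map)
open import Data.Sum as Sum using (_⊎_; inj₁; inj₂)
open import Data.Empty using (⊥-elim)
open import Data.Product using (_×_; _,_; ∃; ∃-syntax; proj₁; proj₂)
open import Data.List using (List; length; map; _++_; allFin)
open import Data.List.Properties using (length-++; length-map; length-tabulate)
open import Data.List.Membership.Propositional using (_∈_)
open import Data.List.Membership.Propositional.Properties using (∈-map⁺; ∈-map⁻; ∈-++⁺ˡ; ∈-++⁺ʳ; ∈-++⁻; ∈-allFin)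
open import Data.List.Relation.Unary.Unique.Propositional using (Unique)
import Data.List.Relation.Unary.Unique.Propositional.Properties as Unique
open import Function using (id; _∘_)
open import Function.Bundles using (_⇔_; mk⇔)
open import Level using (0ℓ)
open import Relation.Binary.PropositionalEquality
open import Relation.Binary.PropositionalEquality.Properties using (setoid)
open import Relation.Nullary using (¬_; yes; no)

module Congruence (p : ℕ) .{{_ : NonZero p}} where
  open Int using (_+_; _*_; -_; _-_)
  open import Data.Integer.Divisibility.Signed using (_∣_; divides; ∣m∣n⇒∣m+n; ∣m⇒∣-m; ∣m⇒∣m*n; ∣n⇒∣m*n; ∣⇒∣ᵤ)
  open ℤ-Solver using (solve-∀)

  infix 4 _≈_
  record _≈_ (a b : ℤ) : Set where
    constructor congruent
    field p∣a-b : + p ∣ a - b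

  ≈-reflexive : ∀ {a b} → a ≡ b → a ≈ b
  ≈-reflexive {a} refl = congruent (divides (+ 0) (ℤₚ.+-inverseʳ a))

  ≈-sym : ∀ {a b} → a ≈ b → b ≈ a
  ≈-sym {a} {b} (congruent a≈b) = congruent (subst (+ p ∣_) (swap a b) (∣m⇒∣-m a≈b))
    where
    swap : ∀ a b → - (a - b) ≡ b - a
    swap = solve-∀

  ≈-trans : ∀ {a b c} → a ≈ b → b ≈ c → a ≈ c
  ≈-trans {a} {b} {c} (congruent a≈b) (congruent b≈c) =
    congruent (subst (+ p ∣_) (telescope a b c) (∣m∣n⇒∣m+n a≈b b≈c))
    where
    telescope : ∀ a b c → (a - b) + (b - c) ≡ a - c
    telescope = solve-∀

  ≈-+ : ∀ {a b c d} → a ≈ b → c ≈ d → a + c ≈ b + d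
  ≈-+ {a} {b} {c} {d} (congruent a≈b) (congruent c≈d) =
    congruent (subst (+ p ∣_) (regroup a b c d) (∣m∣n⇒∣m+n a≈b c≈d))
    where
    regroup : ∀ a b c d → (a - b) + (c - d) ≡ (a + c) - (b + d)
    regroup = solve-∀

  ≈-* : ∀ {a b c d} → a ≈ b → c ≈ d → a * c ≈ b * d
  ≈-* {a} {b} {c} {d} (congruent a≈b) (congruent c≈d) =
    congruent (subst (+ p ∣_) (regroup a b c d) (∣m∣n⇒∣m+n (∣m⇒∣m*n c a≈b) (∣n⇒∣m*n b c≈d)))
    where
    regroup : ∀ a b c d → (a - b) * c + b * (c - d) ≡ a * c - b * d
    regroup = solve-∀

  ≈-neg : ∀ {a b} → a ≈ b → - a ≈ - b
  ≈-neg {a} {b} (congruent a≈b) = congruent (subst (+ p ∣_) (regroup a b) (∣m⇒∣-m a≈b))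
    where
    regroup : ∀ a b → - (a - b) ≡ - a - - b
    regroup = solve-∀

  ≈-+multiple : ∀ a k → + (a ℕ.+ k ℕ.* p) ≈ + a
  ≈-+multiple a k = congruent (divides (+ k) (begin
      + (a ℕ.+ k ℕ.* p) - + a      ≡⟨ cong (_- + a) (trans (ℤₚ.pos-+ a (k ℕ.* p)) (cong (λ t → + a + t) (ℤₚ.pos-* k p))) ⟩
      + a + + k * + p - + a        ≡⟨ cancel (+ a) (+ k) (+ p) ⟩
      + k * + p                    ∎))
    where
    open ≡-Reasoning
    cancel : ∀ a k P → a + k * P - a ≡ k * P
    cancel = solve-∀

  ≈-% : ∀ n → + (n % p) ≈ + n
  ≈-% n = ≈-sym (subst (λ m → + m ≈ + (n % p)) (sym (m≡m%n+[m/n]*n n p)) (≈-+multiple (n % p) (n ℕ./ p)))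

  below-p-divisible : ∀ {d} → d ℕ.< p → p ℕ∣.∣ d → d ≡ 0
  below-p-divisible {zero}  _   _   = refl
  below-p-divisible {suc d} d<p p∣d = ⊥-elim (ℕ∣.>⇒∤ d<p p∣d)

  ≈-injective-≤ : ∀ {a b} → a ℕ.≤ b → b ℕ.< p → + a ≈ + b → a ≡ b
  ≈-injective-≤ {a} {b} a≤b b<p (congruent a≈b) =
    ℕₚ.≤-antisym a≤b (ℕₚ.m∸n≡0⇒m≤n (below-p-divisible (ℕₚ.≤-<-trans (ℕₚ.m∸n≤m b a) b<p) p∣b∸a))
    where
    p∣b∸a : p ℕ∣.∣ b ∸ a
    p∣b∸a = subst (p ℕ∣.∣_) (trans (cong ∣_∣ (ℤₚ.[+m]-[+n]≡m⊖n a b)) (ℤₚ.∣⊖∣-≤ a≤b)) (∣⇒∣ᵤ a≈b)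

  ≈-injective : ∀ {a b} → a ℕ.< p → b ℕ.< p → + a ≈ + b → a ≡ b
  ≈-injective {a} {b} a<p b<p a≈b with ℕₚ.≤-total a b
  ... | inj₁ a≤b = ≈-injective-≤ a≤b b<p a≈b
  ... | inj₂ b≤a = sym (≈-injective-≤ b≤a a<p (≈-sym a≈b))

module Residues (p : ℕ) .{{_ : NonZero p}} where
  open Int using (_+_; _*_; -_; _-_)
  open import Data.Integer.Divisibility.Signed using (divides)
  open Congruence p

  -- ι is opaque so that the solver below compares integer normal forms symbolically
  -- instead of unfolding integer arithmetic on the representatives
  opaque
    ι : Fin p → ℤ
    ι x = + toℕ x

    ι-[_] : ∀ n → ι [ n ]ₚ ≈ + n
    ι-[ n ] = ≈-trans (≈-reflexive (cong +_ (toℕ-fromℕ< _))) (≈-% n)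

    ι-+ : ∀ x y → ι (x +ₚ y) ≈ ι x + ι y
    ι-+ x y = ≈-trans ι-[ toℕ x ℕ.+ toℕ y ] (≈-reflexive (ℤₚ.pos-+ (toℕ x) (toℕ y)))

    ι-* : ∀ x y → ι (x *ₚ y) ≈ ι x * ι y
    ι-* x y = ≈-trans ι-[ toℕ x ℕ.* toℕ y ] (≈-reflexive (ℤₚ.pos-* (toℕ x) (toℕ y)))

    ι-neg : ∀ x → ι (-ₚ x) ≈ - ι x
    ι-neg x = ≈-trans ι-[ p ∸ toℕ x ] (congruent (divides (+ 1) (begin
        + (p ∸ toℕ x) - - ι x   ≡⟨ cong (λ t → + (p ∸ toℕ x) + t) (ℤₚ.neg-involutive (ι x)) ⟩
        + (p ∸ toℕ x) + ι x     ≡⟨ ℤₚ.pos-+ (p ∸ toℕ x) (toℕ x) ⟨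
        + (p ∸ toℕ x ℕ.+ toℕ x) ≡⟨ cong +_ (ℕₚ.m∸n+n≡m (ℕₚ.<⇒≤ (toℕ<n x))) ⟩
        + p                     ≡⟨ ℤₚ.*-identityˡ (+ p) ⟨
        + 1 * + p               ∎)))
      where open ≡-Reasoning

    ι-injective : ∀ {x y} → ι x ≈ ι y → x ≡ y
    ι-injective {x} {y} ιx≈ιy = toℕ-injective (≈-injective (toℕ<n x) (toℕ<n y) ιx≈ιy)

    [toℕ] : ∀ x → [ toℕ x ]ₚ ≡ x
    [toℕ] x = ι-injective ι-[ toℕ x ]

  reduce : ℤ → Fin p
  reduce (+ n)    = [ n ]ₚ
  reduce -[1+ n ] = -ₚ [ suc n ]ₚ

  ι-reduce : ∀ a → ι (reduce a) ≈ a
  ι-reduce (+ n)    = ι-[ n ]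
  ι-reduce -[1+ n ] = ≈-trans (ι-neg [ suc n ]ₚ) (≈-neg ι-[ suc n ])

  rawRing : RawRing 0ℓ 0ℓ
  rawRing = record
    { Carrier = Fin p ; _≈_ = _≡_ ; _+_ = _+ₚ_ ; _*_ = _*ₚ_ ; -_ = -ₚ_ ; 0# = [ 0 ]ₚ ; 1# = [ 1 ]ₚ }

  open Eval rawRing reduce renaming (⟦_⟧ to ⟦_⟧ₚ)
  open ℤ-Reflection using (module Ops)

  transfer : ∀ {n} (e : Expr ℤ n) (ρ : Vec (Fin p) n) → ι (⟦ e ⟧ₚ ρ) ≈ Ops.⟦ e ⟧ (Vec.map ι ρ)
  transfer (Κ c)   ρ = ι-reduce c
  transfer (Ι i)   ρ = ≈-reflexive (sym (lookup-map i ι ρ))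
  transfer (e ⊕ f) ρ = ≈-trans (ι-+ (⟦ e ⟧ₚ ρ) (⟦ f ⟧ₚ ρ)) (≈-+ (transfer e ρ) (transfer f ρ))
  transfer (e ⊗ f) ρ = ≈-trans (ι-* (⟦ e ⟧ₚ ρ) (⟦ f ⟧ₚ ρ)) (≈-* (transfer e ρ) (transfer f ρ))
  transfer (⊝ e)   ρ = ≈-trans (ι-neg _) (≈-neg (transfer e ρ))
  transfer (e ⊛ i) ρ = power i (transfer e ρ)
    where
    _^ₚ_ : Fin p → ℕ → Fin p
    _^ₚ_ = Power._^′_ (RawRing.rawSemiring rawRing)
    _^ℤ_ : ℤ → ℕ → ℤ
    _^ℤ_ = Power._^′_ (RawRing.rawSemiring (ACR.AlmostCommutativeRing.rawRing ℤ-Solver.ring))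
    power : ∀ {x a} i → ι x ≈ a → ι (x ^ₚ i) ≈ a ^ℤ i
    power zero          _    = ι-[ 1 ]
    power (suc zero)    ιx≈a = ιx≈a
    power {x} (suc (suc i)) ιx≈a = ≈-trans (ι-* (x ^ₚ suc i) x) (≈-* (power (suc i) ιx≈a) ιx≈a)

  ⟦_⇓⟧ₚ : ∀ {n} → Expr ℤ n → Vec (Fin p) n → Fin p
  ⟦ e ⇓⟧ₚ ρ = reduce (Ops.⟦ e ⇓⟧ (Vec.map ι ρ))

  correct : ∀ {n} (e : Expr ℤ n) ρ → ⟦ e ⇓⟧ₚ ρ ≡ ⟦ e ⟧ₚ ρ
  correct e ρ = ι-injective (≈-trans (ι-reduce (Ops.⟦ e ⇓⟧ (Vec.map ι ρ)))
                            (≈-trans (≈-reflexive (Ops.correct e (Vec.map ι ρ))) (≈-sym (transfer e ρ))))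

  -- every polynomial identity over ℤ holds in ℤ_p: solve n (λ x₁ … xₙ → lhs ⊜ rhs) refl
  open import Relation.Binary.Reflection (setoid (Fin p)) Ι ⟦_⟧ₚ ⟦_⇓⟧ₚ correct public using (solve; _⊜_)

  []-+ : ∀ m n → [ m ℕ.+ n ]ₚ ≡ [ m ]ₚ +ₚ [ n ]ₚ
  []-+ m n = ι-injective (≈-trans ι-[ m ℕ.+ n ] (≈-trans (≈-reflexive (ℤₚ.pos-+ m n))
                           (≈-sym (≈-trans (ι-+ [ m ]ₚ [ n ]ₚ) (≈-+ ι-[ m ] ι-[ n ])))))

  []-* : ∀ m n → [ m ℕ.* n ]ₚ ≡ [ m ]ₚ *ₚ [ n ]ₚ
  []-* m n = ι-injective (≈-trans ι-[ m ℕ.* n ] (≈-trans (≈-reflexive (ℤₚ.pos-* m n))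
                           (≈-sym (≈-trans (ι-* [ m ]ₚ [ n ]ₚ) (≈-* ι-[ m ] ι-[ n ])))))

  toℕ-[_] : ∀ n → toℕ [ n ]ₚ ≡ n % p
  toℕ-[ n ] = toℕ-fromℕ< _

  toℕ-[0] : toℕ ([_]ₚ {p} 0) ≡ 0
  toℕ-[0] = trans toℕ-[ 0 ] (ℕ∣.n∣m⇒m%n≡0 0 p (ℕ∣.divides 0 refl))

  []≡0⇒∣ : ∀ n → [ n ]ₚ ≡ [ 0 ]ₚ → p ℕ∣.∣ n
  []≡0⇒∣ n [n]≡0 = ℕ∣.m%n≡0⇒n∣m n p (trans (sym toℕ-[ n ]) (trans (cong toℕ [n]≡0) toℕ-[0]))

  ∣⇒[]≡0 : ∀ n → p ℕ∣.∣ n → [ n ]ₚ ≡ [ 0 ]ₚ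
  ∣⇒[]≡0 n p∣n = toℕ-injective (trans toℕ-[ n ] (trans (ℕ∣.n∣m⇒m%n≡0 n p p∣n) (sym toℕ-[0])))

  []-injective : ∀ {m n} → m ℕ.< p → n ℕ.< p → [ m ]ₚ ≡ [ n ]ₚ → m ≡ n
  []-injective {m} {n} m<p n<p [m]≡[n] =
    ≈-injective m<p n<p (≈-trans (≈-sym ι-[ m ]) (≈-trans (≈-reflexive (cong ι [m]≡[n])) ι-[ n ]))

  []≢0 : ∀ {n} → 0 ℕ.< n → n ℕ.< p → [ n ]ₚ ≢ [ 0 ]ₚ
  []≢0 {n} 0<n n<p [n]≡0 = ℕₚ.<⇒≢ 0<n (sym (below-p-divisible n<p ([]≡0⇒∣ n [n]≡0)))

  difference-zero : ∀ {x y} → x -ₚ y ≡ [ 0 ]ₚ → x ≡ y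
  difference-zero {x} {y} x-y≡0 = begin
    x                 ≡⟨ solve 2 (λ x y → x ⊜ ((x ⊕ ⊝ y) ⊕ y)) refl x y ⟩
    (x -ₚ y) +ₚ y     ≡⟨ cong (_+ₚ y) x-y≡0 ⟩
    [ 0 ]ₚ +ₚ y       ≡⟨ solve 1 (λ y → (Κ (+ 0) ⊕ y) ⊜ y) refl y ⟩
    y                 ∎
    where open ≡-Reasoning

  dist² : ∀ {n} → Expr ℤ n → Expr ℤ n → Expr ℤ n → Expr ℤ n → Expr ℤ n
  dist² u₁ u₂ v₁ v₂ = (u₁ ⊕ ⊝ v₁) ⊗ (u₁ ⊕ ⊝ v₁) ⊕ (u₂ ⊕ ⊝ v₂) ⊗ (u₂ ⊕ ⊝ v₂)

  distance-sym : ∀ {x y : Point {p}} → IntegralDistance x y → IntegralDistance y x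
  distance-sym {u₁ , u₂} {v₁ , v₂} (d , uv≡d²) =
    d , trans (solve 4 (λ u₁ u₂ v₁ v₂ → dist² v₁ v₂ u₁ u₂ ⊜ dist² u₁ u₂ v₁ v₂) refl u₁ u₂ v₁ v₂) uv≡d²

  det : Point {p} → Point {p} → Point {p} → Fin p
  det (u₀ , v₀) (u₁ , v₁) (u₂ , v₂) = (u₁ -ₚ u₀) *ₚ (v₂ -ₚ v₀) -ₚ (v₁ -ₚ v₀) *ₚ (u₂ -ₚ u₀)

  detᴱ : ∀ {n} → Expr ℤ n → Expr ℤ n → Expr ℤ n → Expr ℤ n → Expr ℤ n → Expr ℤ n → Expr ℤ n
  detᴱ u₀ v₀ u₁ v₁ u₂ v₂ = (u₁ ⊕ ⊝ u₀) ⊗ (v₂ ⊕ ⊝ v₀) ⊕ ⊝ ((v₁ ⊕ ⊝ v₀) ⊗ (u₂ ⊕ ⊝ u₀))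

  collinear⇒det≡0 : ∀ {S} → Collinear S → ∀ {P₀ P₁ P₂} → S P₀ → S P₁ → S P₂ → det P₀ P₁ P₂ ≡ [ 0 ]ₚ
  collinear⇒det≡0 (a , b , t₁ , t₂ , on-line) {_ , _} {_ , _} {_ , _} S₀ S₁ S₂
    with on-line S₀ | on-line S₁ | on-line S₂
  ... | w₀ , refl , refl | w₁ , refl , refl | w₂ , refl , refl =
    solve 7 (λ a b t₁ t₂ w₀ w₁ w₂ →
               detᴱ (a ⊕ w₀ ⊗ t₁) (b ⊕ w₀ ⊗ t₂) (a ⊕ w₁ ⊗ t₁) (b ⊕ w₁ ⊗ t₂) (a ⊕ w₂ ⊗ t₁) (b ⊕ w₂ ⊗ t₂)
               ⊜ Κ (+ 0))
      refl a b t₁ t₂ w₀ w₁ w₂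

module PrimeModulus (p : ℕ) .{{_ : NonZero p}} (p-prime : Prime p) where
  open Residues p

  no-zero-divisors : ∀ x y → x *ₚ y ≡ [ 0 ]ₚ → x ≡ [ 0 ]ₚ ⊎ y ≡ [ 0 ]ₚ
  no-zero-divisors x y xy≡0 =
    Sum.map vanishes vanishes (euclidsLemma (toℕ x) (toℕ y) p-prime ([]≡0⇒∣ (toℕ x ℕ.* toℕ y) xy≡0))
    where
    vanishes : ∀ {z} → p ℕ∣.∣ toℕ z → z ≡ [ 0 ]ₚ
    vanishes {z} p∣z = trans (sym ([toℕ] z)) (∣⇒[]≡0 (toℕ z) p∣z)

  square-roots : ∀ x y → x *ₚ x ≡ y *ₚ y → x ≡ y ⊎ x +ₚ y ≡ [ 0 ]ₚ
  square-roots x y x²≡y² = Sum.map₁ difference-zero (no-zero-divisors (x -ₚ y) (x +ₚ y) (begin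
    (x -ₚ y) *ₚ (x +ₚ y)     ≡⟨ solve 2 (λ x y → ((x ⊕ ⊝ y) ⊗ (x ⊕ y)) ⊜ (x ⊗ x ⊕ ⊝ (y ⊗ y))) refl x y ⟩
    x *ₚ x -ₚ y *ₚ y         ≡⟨ cong (_-ₚ y *ₚ y) x²≡y² ⟩
    y *ₚ y -ₚ y *ₚ y         ≡⟨ solve 1 (λ z → (z ⊕ ⊝ z) ⊜ Κ (+ 0)) refl (y *ₚ y) ⟩
    [ 0 ]ₚ                   ∎))
    where open ≡-Reasoning

module Configuration
  (p : ℕ) .{{_ : NonZero p}} (p-prime : Prime p)
  (h : ℕ) (p≡2h+1 : p ≡ suc (h ℕ.+ h))
  (ω : ℕ) (0<ω : 0 ℕ.< ω) (ω+ω<p : ω ℕ.+ ω ℕ.< p) (p∣ω²+1 : p ℕ∣.∣ ω ℕ.* ω ℕ.+ 1)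
  where
  open Congruence p using (below-p-divisible)
  open Residues p
  open PrimeModulus p p-prime

  ω̂ : Fin p
  ω̂ = [ ω ]ₚ

  ω̂²+1≡0 : ω̂ *ₚ ω̂ +ₚ [ 1 ]ₚ ≡ [ 0 ]ₚ
  ω̂²+1≡0 = begin
    ω̂ *ₚ ω̂ +ₚ [ 1 ]ₚ     ≡⟨ cong (_+ₚ [ 1 ]ₚ) ([]-* ω ω) ⟨
    [ ω ℕ.* ω ]ₚ +ₚ [ 1 ]ₚ ≡⟨ []-+ (ω ℕ.* ω) 1 ⟨
    [ ω ℕ.* ω ℕ.+ 1 ]ₚ     ≡⟨ ∣⇒[]≡0 (ω ℕ.* ω ℕ.+ 1) p∣ω²+1 ⟩
    [ 0 ]ₚ                 ∎
    where open ≡-Reasoning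

  2ω̂≢0 : ω̂ +ₚ ω̂ ≢ [ 0 ]ₚ
  2ω̂≢0 2ω̂≡0 = []≢0 (ℕₚ.<-≤-trans 0<ω (ℕₚ.m≤m+n ω ω)) ω+ω<p (trans ([]-+ ω ω) 2ω̂≡0)

  integral-up-to-ω̂²+1 : ∀ {X} d K → X ≡ d *ₚ d +ₚ K *ₚ (ω̂ *ₚ ω̂ +ₚ [ 1 ]ₚ) → X ≡ d *ₚ d
  integral-up-to-ω̂²+1 {X} d K X≡ = begin
    X                                        ≡⟨ X≡ ⟩
    d *ₚ d +ₚ K *ₚ (ω̂ *ₚ ω̂ +ₚ [ 1 ]ₚ)     ≡⟨ cong (λ t → d *ₚ d +ₚ K *ₚ t) ω̂²+1≡0 ⟩
    d *ₚ d +ₚ K *ₚ [ 0 ]ₚ                  ≡⟨ solve 2 (λ d K → (d ⊗ d ⊕ K ⊗ Κ (+ 0)) ⊜ (d ⊗ d)) refl d K ⟩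
    d *ₚ d                                   ∎
    where open ≡-Reasoning

  same-line⁺ : ∀ q r → IntegralDistance (q , ω̂ *ₚ q) (r , ω̂ *ₚ r)
  same-line⁺ q r = [ 0 ]ₚ , integral-up-to-ω̂²+1 [ 0 ]ₚ ((q -ₚ r) *ₚ (q -ₚ r))
    (solve 3 (λ q r w → dist² q (w ⊗ q) r (w ⊗ r)
                        ⊜ (Κ (+ 0) ⊗ Κ (+ 0) ⊕ ((q ⊕ ⊝ r) ⊗ (q ⊕ ⊝ r)) ⊗ (w ⊗ w ⊕ Κ (+ 1)))) refl q r ω̂)

  same-line⁻ : ∀ q r → IntegralDistance (q , -ₚ (ω̂ *ₚ q)) (r , -ₚ (ω̂ *ₚ r))
  same-line⁻ q r = [ 0 ]ₚ , integral-up-to-ω̂²+1 [ 0 ]ₚ ((q -ₚ r) *ₚ (q -ₚ r))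
    (solve 3 (λ q r w → dist² q (⊝ (w ⊗ q)) r (⊝ (w ⊗ r))
                        ⊜ (Κ (+ 0) ⊗ Κ (+ 0) ⊕ ((q ⊕ ⊝ r) ⊗ (q ⊕ ⊝ r)) ⊗ (w ⊗ w ⊕ Κ (+ 1)))) refl q r ω̂)

  -- points (i², ω̂i²) and (j², -ω̂j²) on different lines are at distance 2ω̂ij,
  -- because (i² - j²)² + ω̂²(i² + j²)² = (2ω̂ij)² + (i² - j²)²(ω̂² + 1)
  opposite-lines : ∀ i j → IntegralDistance (i *ₚ i , ω̂ *ₚ (i *ₚ i)) (j *ₚ j , -ₚ (ω̂ *ₚ (j *ₚ j)))
  opposite-lines i j = d , integral-up-to-ω̂²+1 d ((i *ₚ i -ₚ j *ₚ j) *ₚ (i *ₚ i -ₚ j *ₚ j))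
    (solve 3 (λ i j w → dist² (i ⊗ i) (w ⊗ (i ⊗ i)) (j ⊗ j) (⊝ (w ⊗ (j ⊗ j)))
                        ⊜ (2wij w i j ⊗ 2wij w i j ⊕ ((i ⊗ i ⊕ ⊝ (j ⊗ j)) ⊗ (i ⊗ i ⊕ ⊝ (j ⊗ j))) ⊗ (w ⊗ w ⊕ Κ (+ 1))))
             refl i j ω̂)
    where
    d : Fin p
    d = ω̂ *ₚ (i *ₚ j +ₚ i *ₚ j)
    2wij : ∀ {n} → Expr ℤ n → Expr ℤ n → Expr ℤ n → Expr ℤ n
    2wij w i j = w ⊗ (i ⊗ j ⊕ i ⊗ j)

  integral-distances : ∀ x y → InP ω x → InP ω y → IntegralDistance x y
  integral-distances (_ , _) (_ , _) (inj₁ ((i , refl) , refl)) (inj₁ ((j , refl) , refl)) = same-line⁺ (i *ₚ i) (j *ₚ j)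
  integral-distances (_ , _) (_ , _) (inj₂ ((i , refl) , refl)) (inj₂ ((j , refl) , refl)) = same-line⁻ (i *ₚ i) (j *ₚ j)
  integral-distances (_ , _) (_ , _) (inj₁ ((i , refl) , refl)) (inj₂ ((j , refl) , refl)) = opposite-lines i j
  integral-distances (_ , _) (_ , _) (inj₂ ((i , refl) , refl)) (inj₁ ((j , refl) , refl)) = distance-sym (opposite-lines j i)

  not-collinear : ¬ Collinear (InP ω)
  not-collinear collinear = 2ω̂≢0 (begin
    ω̂ +ₚ ω̂            ≡⟨ solve 1 (λ w → (w ⊕ w) ⊜ detᴱ 1ᴱ (w ⊗ 1ᴱ) 0ᴱ (w ⊗ 0ᴱ) 1ᴱ (⊝ (w ⊗ 1ᴱ))) refl ω̂ ⟩
    det P₀ P₁ P₂      ≡⟨ collinear⇒det≡0 collinear {P₀} {P₁} {P₂}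
                           (inj₁ (([ 1 ]ₚ , refl) , refl)) (inj₁ (([ 0 ]ₚ , refl) , refl)) (inj₂ (([ 1 ]ₚ , refl) , refl)) ⟩
    [ 0 ]ₚ            ∎)
    where
    open ≡-Reasoning
    1ᴱ 0ᴱ : Expr ℤ 1
    1ᴱ = Κ (+ 1) ⊗ Κ (+ 1)
    0ᴱ = Κ (+ 0) ⊗ Κ (+ 0)
    1² 0² : Fin p
    1² = [ 1 ]ₚ *ₚ [ 1 ]ₚ
    0² = [ 0 ]ₚ *ₚ [ 0 ]ₚ
    P₀ P₁ P₂ : Point {p}
    P₀ = 1² , ω̂ *ₚ 1²
    P₁ = 0² , ω̂ *ₚ 0²
    P₂ = 1² , -ₚ (ω̂ *ₚ 1²)

  ≤h⇒<p : ∀ {n} → n ℕ.≤ h → n ℕ.< p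
  ≤h⇒<p {n} n≤h = subst (n ℕ.<_) (sym p≡2h+1) (ℕ.s≤s (ℕₚ.≤-trans n≤h (ℕₚ.m≤m+n h h)))

  sq : ℕ → Fin p
  sq n = [ n ]ₚ *ₚ [ n ]ₚ

  -- the squares of 0, 1, …, h are distinct: the square roots of sq n are ±n, and n + m < p
  sq-injective : ∀ {m n} → m ℕ.≤ h → n ℕ.≤ h → sq m ≡ sq n → m ≡ n
  sq-injective {m} {n} m≤h n≤h sq-m≡sq-n = Sum.[ equal , opposite ] (square-roots [ m ]ₚ [ n ]ₚ sq-m≡sq-n)
    where
    equal : [ m ]ₚ ≡ [ n ]ₚ → m ≡ n
    equal = []-injective (≤h⇒<p m≤h) (≤h⇒<p n≤h)
    opposite : [ m ]ₚ +ₚ [ n ]ₚ ≡ [ 0 ]ₚ → m ≡ n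
    opposite [m]+[n]≡0 = trans (ℕₚ.m+n≡0⇒m≡0 m m+n≡0) (sym (ℕₚ.m+n≡0⇒n≡0 m m+n≡0))
      where
      m+n<p : m ℕ.+ n ℕ.< p
      m+n<p = subst (m ℕ.+ n ℕ.<_) (sym p≡2h+1) (ℕ.s≤s (ℕₚ.+-mono-≤ m≤h n≤h))
      m+n≡0 : m ℕ.+ n ≡ 0
      m+n≡0 = below-p-divisible m+n<p ([]≡0⇒∣ (m ℕ.+ n) (trans ([]-+ m n) [m]+[n]≡0))

  -- every square is sq j for some j ≤ h, as k² = (-k)² and one of k, -k has representative ≤ h
  square-representative : ∀ k → ∃[ j ] (j ℕ.≤ h × k *ₚ k ≡ sq j)
  square-representative k with toℕ k ℕ.≤? h
  ... | yes k≤h = toℕ k , k≤h , sym (cong (λ z → z *ₚ z) ([toℕ] k))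
  ... | no  k≰h = p ∸ toℕ k , p-k≤h , solve 1 (λ k → (k ⊗ k) ⊜ (⊝ k ⊗ ⊝ k)) refl k
    where
    p-k≤h : p ∸ toℕ k ℕ.≤ h
    p-k≤h = begin
      p ∸ toℕ k             ≤⟨ ℕₚ.∸-monoʳ-≤ p (ℕₚ.≰⇒> k≰h) ⟩
      p ∸ suc h             ≡⟨ cong (_∸ suc h) p≡2h+1 ⟩
      suc h ℕ.+ h ∸ suc h   ≡⟨ ℕₚ.m+n∸m≡n (suc h) h ⟩
      h                     ∎
      where open ℕₚ.≤-Reasoning

  lines-disjoint : ∀ {n} → 0 ℕ.< n → n ℕ.≤ h → ω̂ *ₚ sq n ≢ -ₚ (ω̂ *ₚ sq n)
  lines-disjoint {n} 0<n n≤h on-both =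
    Sum.[ 2ω̂≢0 , n²≢0 ] (no-zero-divisors (ω̂ +ₚ ω̂) (sq n) 2ω̂n²≡0)
    where
    n²≢0 : sq n ≢ [ 0 ]ₚ
    n²≢0 n²≡0 = []≢0 0<n (≤h⇒<p n≤h) (Sum.[ id , id ] (no-zero-divisors [ n ]ₚ [ n ]ₚ n²≡0))
    2ω̂n²≡0 : (ω̂ +ₚ ω̂) *ₚ sq n ≡ [ 0 ]ₚ
    2ω̂n²≡0 = begin
      (ω̂ +ₚ ω̂) *ₚ sq n                 ≡⟨ solve 2 (λ w q → ((w ⊕ w) ⊗ q) ⊜ (w ⊗ q ⊕ ⊝ (⊝ (w ⊗ q)))) refl ω̂ (sq n) ⟩
      ω̂ *ₚ sq n -ₚ (-ₚ (ω̂ *ₚ sq n))    ≡⟨ cong (λ t → ω̂ *ₚ sq n -ₚ t) on-both ⟨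
      ω̂ *ₚ sq n -ₚ ω̂ *ₚ sq n           ≡⟨ solve 1 (λ z → (z ⊕ ⊝ z) ⊜ Κ (+ 0)) refl (ω̂ *ₚ sq n) ⟩
      [ 0 ]ₚ                              ∎
      where open ≡-Reasoning

  P⁺ P⁻ : ℕ → Point {p}
  P⁺ n = sq n , ω̂ *ₚ sq n
  P⁻ n = sq n , -ₚ (ω̂ *ₚ sq n)

  P⁻0≡P⁺0 : P⁻ 0 ≡ P⁺ 0
  P⁻0≡P⁺0 = cong (sq 0 ,_) (solve 1 (λ w → ⊝ (w ⊗ 0ᴱ) ⊜ (w ⊗ 0ᴱ)) refl ω̂)
    where
    0ᴱ : Expr ℤ 1
    0ᴱ = Κ (+ 0) ⊗ Κ (+ 0)

  upper lower points : List (Point {p})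
  upper  = map (P⁺ ∘ toℕ) (allFin (suc h))
  lower  = map (P⁻ ∘ suc ∘ toℕ) (allFin h)
  points = upper ++ lower

  P⁺∈points : ∀ {n} → n ℕ.≤ h → P⁺ n ∈ points
  P⁺∈points {n} n≤h = ∈-++⁺ˡ (subst (λ m → P⁺ m ∈ upper) (toℕ-fromℕ< (ℕ.s≤s n≤h))
                               (∈-map⁺ (P⁺ ∘ toℕ) (∈-allFin (fromℕ< (ℕ.s≤s n≤h)))))

  P⁻∈points : ∀ {n} → n ℕ.≤ h → P⁻ n ∈ points
  P⁻∈points {zero}  _   = subst (_∈ points) (sym P⁻0≡P⁺0) (P⁺∈points ℕ.z≤n)
  P⁻∈points {suc n} n<h = ∈-++⁺ʳ upper (subst (λ m → P⁻ (suc m) ∈ lower) (toℕ-fromℕ< n<h)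
                                         (∈-map⁺ (P⁻ ∘ suc ∘ toℕ) (∈-allFin (fromℕ< n<h))))

  points⊆𝒫 : ∀ x → x ∈ points → InP ω x
  points⊆𝒫 x x∈points with ∈-++⁻ upper x∈points
  ... | inj₁ x∈upper with ∈-map⁻ (P⁺ ∘ toℕ) x∈upper
  ...   | i , _ , refl = inj₁ (([ toℕ i ]ₚ , refl) , refl)
  points⊆𝒫 x x∈points | inj₂ x∈lower with ∈-map⁻ (P⁻ ∘ suc ∘ toℕ) x∈lower
  ...   | i , _ , refl = inj₂ (([ suc (toℕ i) ]ₚ , refl) , refl)

  𝒫⊆points : ∀ x → InP ω x → x ∈ points
  𝒫⊆points (_ , _) (inj₁ ((k , refl) , refl)) with square-representative k
  ... | j , j≤h , k²≡j² = subst (λ q → (q , ω̂ *ₚ q) ∈ points) (sym k²≡j²) (P⁺∈points j≤h)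
  𝒫⊆points (_ , _) (inj₂ ((k , refl) , refl)) with square-representative k
  ... | j , j≤h , k²≡j² = subst (λ q → (q , -ₚ (ω̂ *ₚ q)) ∈ points) (sym k²≡j²) (P⁻∈points j≤h)

  points-unique : Unique points
  points-unique = Unique.++⁺ (Unique.map⁺ upper-injective (Unique.allFin⁺ (suc h)))
                             (Unique.map⁺ lower-injective (Unique.allFin⁺ h)) disjoint
    where
    upper-injective : ∀ {i j : Fin (suc h)} → P⁺ (toℕ i) ≡ P⁺ (toℕ j) → i ≡ j
    upper-injective {i} {j} eq = toℕ-injective (sq-injective (ℕₚ.≤-pred (toℕ<n i)) (ℕₚ.≤-pred (toℕ<n j)) (cong proj₁ eq))
    lower-injective : ∀ {i j : Fin h} → P⁻ (suc (toℕ i)) ≡ P⁻ (suc (toℕ j)) → i ≡ j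
    lower-injective {i} {j} eq = toℕ-injective (ℕₚ.suc-injective (sq-injective (toℕ<n i) (toℕ<n j) (cong proj₁ eq)))
    disjoint : ∀ {x} → ¬ (x ∈ upper × x ∈ lower)
    disjoint (x∈upper , x∈lower) with ∈-map⁻ (P⁺ ∘ toℕ) x∈upper | ∈-map⁻ (P⁻ ∘ suc ∘ toℕ) x∈lower
    ... | i , _ , refl | j , _ , P⁺i≡P⁻j =
      lines-disjoint ℕ.z<s (toℕ<n j) (subst (λ m → ω̂ *ₚ sq m ≡ -ₚ (ω̂ *ₚ sq (suc (toℕ j)))) i≡1+j (cong proj₂ P⁺i≡P⁻j))
      where
      i≡1+j : toℕ i ≡ suc (toℕ j)
      i≡1+j = sq-injective (ℕₚ.≤-pred (toℕ<n i)) (toℕ<n j) (cong proj₁ P⁺i≡P⁻j)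

  points-length : length points ≡ p
  points-length = begin
    length (upper ++ lower)         ≡⟨ length-++ upper ⟩
    length upper ℕ.+ length lower   ≡⟨ cong₂ ℕ._+_ (trans (length-map _ (allFin (suc h))) (length-tabulate {n = suc h} id))
                                                  (trans (length-map _ (allFin h)) (length-tabulate {n = h} id)) ⟩
    suc h ℕ.+ h                     ≡⟨ p≡2h+1 ⟨
    p                               ∎
    where open ≡-Reasoning

open import Data.Nat using (ℕ; NonZero; _<_; _*_; _+_; _%_)
open import Data.Nat.Divisibility using (_∣_)

-- p ≡ 1 (mod 4) makes p odd, p = 2h + 1 with h = 2⌊p/4⌋
odd-decomposition : ∀ p → p % 4 ≡ 1 → p ≡ suc (p ℕ./ 4 * 2 + p ℕ./ 4 * 2)
odd-decomposition p p%4≡1 = begin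
  p                             ≡⟨ m≡m%n+[m/n]*n p 4 ⟩
  p % 4 + p ℕ./ 4 * 4           ≡⟨ cong (λ r → r + p ℕ./ 4 * 4) p%4≡1 ⟩
  suc (p ℕ./ 4 * 4)             ≡⟨ cong suc (ℕₚ.*-distribˡ-+ (p ℕ./ 4) 2 2) ⟩
  suc (p ℕ./ 4 * 2 + p ℕ./ 4 * 2) ∎
  where open ≡-Reasoning

lemma5 : (p : ℕ) .{{_ : NonZero p}} → Prime p → p % 4 ≡ 1 →
    (ω : ℕ) → 0 < ω → 2 * ω < p → p ∣ ω * ω + 1 →
    (∃[ xs ] (Unique xs × length xs ≡ p × (∀ x → (x ∈ xs) ⇔ InP {p} ω x)))
    × (∀ x y → InP {p} ω x → InP {p} ω y → IntegralDistance x y)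
    × ¬ Collinear (InP {p} ω)
lemma5 p p-prime p%4≡1 ω 0<ω 2ω<p p∣ω²+1 =
  (points , points-unique , points-length , λ x → mk⇔ (points⊆𝒫 x) (𝒫⊆points x)) ,
  integral-distances ,
  not-collinear
  where
  ω+ω<p : ω + ω < p
  ω+ω<p = subst (_< p) (cong (λ t → ω + t) (ℕₚ.+-identityʳ ω)) 2ω<p
  open Configuration p p-prime (p ℕ./ 4 * 2) (odd-decomposition p p%4≡1) ω 0<ω ω+ω<p p∣ω²+1
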